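{- Let $G$ be a polarity graph of a projective plane of order $q$, and let $S$ be a subset of $V(G)$. Let $e(S)$ denote the number of edges of $G$ with both endpoints in $S$, where loops at vertices of $S$ are counted as edges. Then \[ e(S) \geq \frac{(q+1)|S|^2}{2(q^2+q+1)} - \frac{\sqrt{q}\,|S|}{2}. \]
   Context: A projective plane of order $q$ is a triple $(\mathcal{P},\mathcal{L},\mathcal{I})$ of a finite set of points $\mathcal{P}$, a disjoint finite set of lines $\mathcal{L}$ and an incidence relation $\mathcal{I}\subset\mathcal{P}\times\mathcal{L}$ such that every line contains $q+1$ points, every point lies on $q+1$ lines, any two distinct points lie on a unique common line and any two distinct lines meet in a unique point (so $|\mathcal{P}|=q^2+q+1$). A polarity is a bijection $\pi$ of $\mathcal{P}\cup\mathcal{L}$ that maps points to lines and lines to points, is an involution, and preserves incidence. The polarity graph $G=G_\pi$ has vertex set $\mathcal{P}$ and edge set $\{\{p,r\} : p,r\in\mathcal{P},\ (p,\pi(r))\in\mathcal{I}\}$; it has a loop at each point $p$ with $(p,\pi(p))\in\mathcal{I}$. -}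

module Defs where

open import Data.Nat using (ℕ; suc; _+_; _*_; _^_; _<_; _<?_)
open import Data.Fin using (Fin; toℕ)
open import Data.Fin.Subset using (Subset; _∈_; ∣_∣)
open import Data.Fin.Subset.Properties using (_∈?_)
open import Data.List using (length; filter; map; allFin)
open import Data.Nat.ListAction using (sum)
open import Data.Product using (_×_; ∃!)
open import Relation.Nullary using (Dec; ¬_)
open import Relation.Nullary.Decidable using (_×-dec_)
open import Relation.Binary.PropositionalEquality using (_≡_; _≢_)

count : ∀ {n} {P : Fin n → Set} → (∀ x → Dec (P x)) → ℕ
count {n} P? = length (filter P? (allFin n))

countPairs : ∀ {n} {R : Fin n → Fin n → Set} → (∀ x y → Dec (R x y)) → ℕ
countPairs {n} R? = sum (map (λ x → count (R? x)) (allFin n))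

record ProjectivePlane (q : ℕ) : Set₁ where
  field
    np nl : ℕ
    I : Fin np → Fin nl → Set
    I? : ∀ p l → Dec (I p l)
    line-size : ∀ l → count (λ p → I? p l) ≡ suc q
    point-degree : ∀ p → count (λ l → I? p l) ≡ suc q
    two-points : ∀ p r → p ≢ r → ∃! _≡_ (λ l → I p l × I r l)
    two-lines : ∀ l m → l ≢ m → ∃! _≡_ (λ p → I p l × I p m)

-- A polarity: an involutive bijection of P ∪ L swapping points and lines
-- and preserving incidence; given by its two halves πP : P → L, πL : L → P.
record Polarity {q : ℕ} (Π : ProjectivePlane q) : Set where
  open ProjectivePlane Π
  field
    πP : Fin np → Fin nl
    πL : Fin nl → Fin np
    invP : ∀ p → πL (πP p) ≡ p
    invL : ∀ l → πP (πL l) ≡ l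
    preserves : ∀ p l → I p l → I (πL l) (πP p)

-- e(S): number of edges {p , r} (p ≠ r, counted once via toℕ p < toℕ r) of the
-- polarity graph with p , r ∈ S, plus the number of loops at vertices of S.
edgesIn : ∀ {q} (Π : ProjectivePlane q) → Polarity Π → Subset (ProjectivePlane.np Π) → ℕ
edgesIn Π π S =
    countPairs (λ p r → (p ∈? S) ×-dec ((r ∈? S) ×-dec ((toℕ p <? toℕ r) ×-dec I? p (πP r))))
  + count (λ p → (p ∈? S) ×-dec I? p (πP p))
  where
    open ProjectivePlane Π
    open Polarity π

module Submission where

-- Let A be the adjacency matrix of the polarity graph, A x y = [x ∈ π(y)], and v the
-- indicator vector of S, with s = |S| and n points. Two distinct lines meet in exactly one
-- point, so AᵀA = J + qI: this forces n = q² + q + 1, and for every u with Σ u = 0 it gives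
-- |Au|² = q|u|², whence (uᵀAu)² ≤ q|u|⁴ by Cauchy–Schwarz. For u = n v − s·1 this reads
-- (n vᵀAv − (q+1)s²)² ≤ q (ns − s²)² ≤ q n² s², and vᵀAv = 2e(S) − #loops ≤ 2e(S).

open import Defs

open import Level using (Level)
open import Data.Nat as ℕ using (ℕ; zero; suc; z≤n)
import Data.Nat.Properties as ℕP
open import Data.Integer as ℤ using (ℤ; +_; -[1+_]; +≤+; 0ℤ; 1ℤ; _+_; _-_; _*_; -_; _≤_)
import Data.Integer.Properties as ℤP
open import Data.Integer.Tactic.RingSolver using (solve-∀)
open import Data.Nat.Tactic.RingSolver using () renaming (solve-∀ to ℕ-solve-∀)
open import Data.Fin using (Fin; zero; suc; toℕ; _≟_)
open import Data.Fin.Properties using (toℕ-injective)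
open import Data.Vec.Functional using (Vector)
open import Data.Vec using ([]; _∷_)
open import Data.Bool using (true; false; if_then_else_)
open import Function using (_∘_)
open import Data.Fin.Subset using (Subset; ∣_∣; _∈_)
open import Data.Fin.Subset.Properties using (_∈?_; ∣p∣≤n)
open import Data.List using (length; filter; map; tabulate)
import Data.Nat.ListAction as List
open import Data.Product using (_×_; _,_)
open import Relation.Nullary using (Dec; does; yes; no; ¬_; contradiction)
open import Relation.Nullary.Decidable using (_×-dec_)
open import Relation.Unary using (Pred; Decidable)
open import Relation.Binary.PropositionalEquality
open import Relation.Binary.Definitions using (tri<; tri≈; tri>)
open import Algebra.Properties.Semiring.Sum ℤP.+-*-semiring

private
  variable
    ℓ ℓ′ : Level
    A : Set ℓ
    P P′ : Set ℓ
    m n : ℕ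

-- Defined through 'does', so that it computes on decisions built by 'map′', such as '_∈?_'.
⟦_⟧ : Dec P → ℤ
⟦ d ⟧ = if does d then 1ℤ else 0ℤ

⟦⟧-yes : (d : Dec P) → P → ⟦ d ⟧ ≡ 1ℤ
⟦⟧-yes (yes _) _ = refl
⟦⟧-yes (no ¬p) p = contradiction p ¬p

⟦⟧-no : (d : Dec P) → ¬ P → ⟦ d ⟧ ≡ 0ℤ
⟦⟧-no (yes p) ¬p = contradiction p ¬p
⟦⟧-no (no _) _ = refl

⟦⟧-cong : (d : Dec P) (e : Dec P′) → (P → P′) → (P′ → P) → ⟦ d ⟧ ≡ ⟦ e ⟧
⟦⟧-cong (yes p) e to from = sym (⟦⟧-yes e (to p))
⟦⟧-cong (no ¬p) e to from = sym (⟦⟧-no e (λ q → ¬p (from q)))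

⟦⟧-× : (d : Dec P) (e : Dec P′) → ⟦ d ×-dec e ⟧ ≡ ⟦ d ⟧ * ⟦ e ⟧
⟦⟧-× (yes _) (yes _) = refl
⟦⟧-× (yes _) (no _) = refl
⟦⟧-× (no _) (yes _) = refl
⟦⟧-× (no _) (no _) = refl

⟦⟧-idem : (d : Dec P) → ⟦ d ⟧ * ⟦ d ⟧ ≡ ⟦ d ⟧
⟦⟧-idem (yes _) = refl
⟦⟧-idem (no _) = refl

⟦⟧-nonneg : (d : Dec P) → 0ℤ ≤ ⟦ d ⟧
⟦⟧-nonneg (yes _) = +≤+ z≤n
⟦⟧-nonneg (no _) = +≤+ z≤n

sq-nonneg : ∀ x → 0ℤ ≤ x * x
sq-nonneg (+ m) = subst (0ℤ ≤_) (ℤP.pos-* m m) (+≤+ z≤n)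
sq-nonneg -[1+ m ] = +≤+ z≤n

sq-mono-≤ : ∀ {x y} → 0ℤ ≤ x → x ≤ y → x * x ≤ y * y
sq-mono-≤ {+ m} {+ m′} (+≤+ _) (+≤+ m≤m′) =
  subst₂ _≤_ (ℤP.pos-* m m) (ℤP.pos-* m′ m′) (+≤+ (ℕP.*-mono-≤ m≤m′ m≤m′))

pos-^2 : ∀ m → + (m ℕ.^ 2) ≡ + m * + m
pos-^2 m = trans (ℤP.pos-* m (m ℕ.* 1)) (cong (λ t → + m * + t) (ℕP.*-identityʳ m))

pos-a*b²*c² : ∀ a b c → + (a ℕ.* b ℕ.^ 2 ℕ.* c ℕ.^ 2) ≡ + a * ((+ b * + c) * (+ b * + c))
pos-a*b²*c² a b c = begin
  + (a ℕ.* b ℕ.^ 2 ℕ.* c ℕ.^ 2)       ≡⟨ ℤP.pos-* (a ℕ.* b ℕ.^ 2) (c ℕ.^ 2) ⟩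
  + (a ℕ.* b ℕ.^ 2) * + (c ℕ.^ 2)     ≡⟨ cong₂ _*_ (trans (ℤP.pos-* a (b ℕ.^ 2)) (cong (+ a *_) (pos-^2 b)))
                                                    (pos-^2 c) ⟩
  + a * (+ b * + b) * (+ c * + c)     ≡⟨ regroup (+ a) (+ b) (+ c) ⟩
  + a * ((+ b * + c) * (+ b * + c))   ∎
  where
  open ≡-Reasoning
  regroup : ∀ a b c → a * (b * b) * (c * c) ≡ a * ((b * c) * (b * c))
  regroup = solve-∀

∸-sq-≤ : ∀ m n {x} → + m - + n ≤ x → + (m ℕ.∸ n) * + (m ℕ.∸ n) ≤ x * x
∸-sq-≤ m n {x} m-n≤x with m ℕ.≤? n
... | yes m≤n rewrite ℕP.m≤n⇒m∸n≡0 m≤n = sq-nonneg x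
... | no m≰n = sq-mono-≤ (+≤+ z≤n) (subst (_≤ x) m-n≡m∸n m-n≤x)
  where
  m-n≡m∸n : + m - + n ≡ + (m ℕ.∸ n)
  m-n≡m∸n = trans (ℤP.m-n≡m⊖n m n) (ℤP.⊖-≥ (ℕP.≰⇒≥ m≰n))

sq-[yx-x²]≤sq-yx : ∀ {x y} → 0ℤ ≤ x → x ≤ y → (y * x - x * x) * (y * x - x * x) ≤ (y * x) * (y * x)
sq-[yx-x²]≤sq-yx {x} {y} 0≤x x≤y = sq-mono-≤ (ℤP.i≤j⇒0≤j-i x²≤yx) yx-x²≤yx
  where
  x²≤yx : x * x ≤ y * x
  x²≤yx = ℤP.*-monoʳ-≤-nonNeg x {{ℤ.nonNegative 0≤x}} x≤y
  gap : ∀ a b → a - (a - b) ≡ b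
  gap = solve-∀
  yx-x²≤yx : y * x - x * x ≤ y * x
  yx-x²≤yx = ℤP.0≤i-j⇒j≤i (subst (0ℤ ≤_) (sym (gap (y * x) (x * x))) (sq-nonneg x))

∑-const : ∀ n c → ∑[ i < n ] c ≡ + n * c
∑-const zero c = refl
∑-const (suc n) c = begin
  c + ∑[ i < n ] c  ≡⟨ cong (λ t → c + t) (∑-const n c) ⟩
  c + + n * c       ≡⟨ factor c (+ n) ⟩
  (1ℤ + + n) * c    ∎
  where
  open ≡-Reasoning
  factor : ∀ c n → c + n * c ≡ (1ℤ + n) * c
  factor = solve-∀

∑-nonneg : (f : Vector ℤ n) → (∀ i → 0ℤ ≤ f i) → 0ℤ ≤ sum f
∑-nonneg {zero} f f≥0 = +≤+ z≤n
∑-nonneg {suc n} f f≥0 = ℤP.+-mono-≤ (f≥0 zero) (∑-nonneg (λ i → f (suc i)) (λ i → f≥0 (suc i)))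

∑-linear : ∀ (x y : ℤ) (f g : Vector ℤ n) →
           ∑[ i < n ] (x * f i + y * g i) ≡ x * sum f + y * sum g
∑-linear x y f g = trans (∑-distrib-+ (λ i → x * f i) (λ i → y * g i))
                         (sym (cong₂ _+_ (*-distribˡ-sum x f) (*-distribˡ-sum y g)))

∑∑-* : (f : Vector ℤ m) (g : Vector ℤ n) → ∑[ i < m ] ∑[ j < n ] (f i * g j) ≡ sum f * sum g
∑∑-* f g = trans (sum-cong-≗ (λ i → sym (*-distribˡ-sum (f i) g))) (sym (*-distribʳ-sum _ f))

∑-δ : (j : Fin n) (f : Vector ℤ n) → ∑[ i < n ] (f i * ⟦ j ≟ i ⟧) ≡ f j
∑-δ {suc n} zero f = begin
  f zero * 1ℤ + ∑[ i < n ] (f (suc i) * 0ℤ)  ≡⟨ cong₂ _+_ (ℤP.*-identityʳ (f zero)) ∑f*0≡0 ⟩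
  f zero + 0ℤ                                 ≡⟨ ℤP.+-identityʳ (f zero) ⟩
  f zero                                      ∎
  where
  open ≡-Reasoning
  ∑f*0≡0 : ∑[ i < n ] (f (suc i) * 0ℤ) ≡ 0ℤ
  ∑f*0≡0 = trans (sym (*-distribʳ-sum 0ℤ (λ i → f (suc i)))) (ℤP.*-zeroʳ (∑[ i < n ] f (suc i)))
∑-δ {suc n} (suc j) f rewrite ℤP.*-zeroʳ (f zero) =
  trans (ℤP.+-identityˡ _) (∑-δ j (λ i → f (suc i)))

∑∑-distrib-+ : (F G : Fin m → Fin n → ℤ) →
               ∑[ i < m ] ∑[ j < n ] (F i j + G i j)
                 ≡ ∑[ i < m ] ∑[ j < n ] F i j + ∑[ i < m ] ∑[ j < n ] G i j
∑∑-distrib-+ {n = n} F G = trans (sum-cong-≗ (λ i → ∑-distrib-+ (F i) (G i)))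
                                 (∑-distrib-+ (λ i → ∑[ j < n ] F i j) (λ i → ∑[ j < n ] G i j))

⟦<⟧+⟦>⟧+⟦≡⟧ : (i j : Fin n) → ⟦ toℕ i ℕ.<? toℕ j ⟧ + ⟦ toℕ j ℕ.<? toℕ i ⟧ + ⟦ i ≟ j ⟧ ≡ 1ℤ
⟦<⟧+⟦>⟧+⟦≡⟧ i j with ℕP.<-cmp (toℕ i) (toℕ j)
... | tri< i<j i≢j j≮i
  rewrite ⟦⟧-yes (toℕ i ℕ.<? toℕ j) i<j | ⟦⟧-no (toℕ j ℕ.<? toℕ i) j≮i
        | ⟦⟧-no (i ≟ j) (λ i≡j → i≢j (cong toℕ i≡j)) = refl
... | tri≈ i≮j i≡j j≮i
  rewrite ⟦⟧-no (toℕ i ℕ.<? toℕ j) i≮j | ⟦⟧-no (toℕ j ℕ.<? toℕ i) j≮i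
        | ⟦⟧-yes (i ≟ j) (toℕ-injective i≡j) = refl
... | tri> i≮j i≢j j<i
  rewrite ⟦⟧-no (toℕ i ℕ.<? toℕ j) i≮j | ⟦⟧-yes (toℕ j ℕ.<? toℕ i) j<i
        | ⟦⟧-no (i ≟ j) (λ i≡j → i≢j (cong toℕ i≡j)) = refl

∑∑-symmetric : (f : Fin n → Fin n → ℤ) → (∀ i j → f i j ≡ f j i) →
               ∑[ i < n ] ∑[ j < n ] f i j
                 ≡ + 2 * ∑[ i < n ] ∑[ j < n ] (⟦ toℕ i ℕ.<? toℕ j ⟧ * f i j) + ∑[ i < n ] f i i
∑∑-symmetric {n} f f-sym = begin
  ∑[ i < n ] ∑[ j < n ] f i j
    ≡⟨ sum-cong-≗ (λ i → sum-cong-≗ (λ j → split i j)) ⟩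
  ∑[ i < n ] ∑[ j < n ] (upper i j + upper j i + f i j * ⟦ i ≟ j ⟧)
    ≡⟨ ∑∑-distrib-+ (λ i j → upper i j + upper j i) (λ i j → f i j * ⟦ i ≟ j ⟧) ⟩
  ∑[ i < n ] ∑[ j < n ] (upper i j + upper j i) + ∑[ i < n ] ∑[ j < n ] (f i j * ⟦ i ≟ j ⟧)
    ≡⟨ cong₂ _+_ (∑∑-distrib-+ upper (λ i j → upper j i)) (sum-cong-≗ (λ i → ∑-δ i (f i))) ⟩
  U + ∑[ i < n ] ∑[ j < n ] upper j i + ∑[ i < n ] f i i
    ≡⟨ cong (λ t → U + t + ∑[ i < n ] f i i) (∑-comm (λ i j → upper j i)) ⟩
  U + U + ∑[ i < n ] f i i
    ≡⟨ cong (λ t → t + ∑[ i < n ] f i i) (double U) ⟩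
  + 2 * U + ∑[ i < n ] f i i ∎
  where
  open ≡-Reasoning
  upper : Fin n → Fin n → ℤ
  upper i j = ⟦ toℕ i ℕ.<? toℕ j ⟧ * f i j
  U : ℤ
  U = ∑[ i < n ] ∑[ j < n ] upper i j
  double : ∀ x → x + x ≡ + 2 * x
  double = solve-∀
  split : ∀ i j → f i j ≡ upper i j + upper j i + f i j * ⟦ i ≟ j ⟧
  split i j = begin
    f i j                                        ≡⟨ sym (ℤP.*-identityʳ (f i j)) ⟩
    f i j * 1ℤ                                   ≡⟨ cong (f i j *_) (sym (⟦<⟧+⟦>⟧+⟦≡⟧ i j)) ⟩
    f i j * (⟦ i<j ⟧ + ⟦ j<i ⟧ + ⟦ i≟j ⟧)        ≡⟨ distribute ⟦ i<j ⟧ ⟦ j<i ⟧ ⟦ i≟j ⟧ (f i j) ⟩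
    ⟦ i<j ⟧ * f i j + ⟦ j<i ⟧ * f i j + f i j * ⟦ i≟j ⟧
      ≡⟨ cong (λ t → ⟦ i<j ⟧ * f i j + ⟦ j<i ⟧ * t + f i j * ⟦ i≟j ⟧) (f-sym i j) ⟩
    upper i j + upper j i + f i j * ⟦ i≟j ⟧      ∎
    where
    i<j = toℕ i ℕ.<? toℕ j
    j<i = toℕ j ℕ.<? toℕ i
    i≟j = i ≟ j
    distribute : ∀ a b c x → x * (a + b + c) ≡ a * x + b * x + x * c
    distribute = solve-∀

length-filter-tabulate : {R : Pred A ℓ′} (R? : Decidable R) (f : Fin n → A) →
                         + length (filter R? (tabulate f)) ≡ ∑[ i < n ] ⟦ R? (f i) ⟧
length-filter-tabulate {n = zero} R? f = refl
length-filter-tabulate {n = suc n} R? f with R? (f zero)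
... | yes _ = trans (ℤP.pos-+ 1 _) (cong (λ t → 1ℤ + t) (length-filter-tabulate R? (λ i → f (suc i))))
... | no _ = trans (length-filter-tabulate R? (λ i → f (suc i))) (sym (ℤP.+-identityˡ _))

sum-map-tabulate : (g : A → ℕ) (f : Fin n → A) → + List.sum (map g (tabulate f)) ≡ ∑[ i < n ] (+ g (f i))
sum-map-tabulate {n = zero} g f = refl
sum-map-tabulate {n = suc n} g f =
  trans (ℤP.pos-+ (g (f zero)) _) (cong (λ t → + g (f zero) + t) (sum-map-tabulate g (λ i → f (suc i))))

count-≡-∑ : {R : Fin n → Set} (R? : Decidable R) → + count R? ≡ ∑[ i < n ] ⟦ R? i ⟧
count-≡-∑ R? = length-filter-tabulate R? (λ i → i)

countPairs-≡-∑∑ : {R : Fin n → Fin n → Set} (R? : ∀ i j → Dec (R i j)) →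
                  + countPairs R? ≡ ∑[ i < n ] ∑[ j < n ] ⟦ R? i j ⟧
countPairs-≡-∑∑ {n} R? = trans (sum-map-tabulate (λ i → count (R? i)) (λ i → i))
                               (sum-cong-≗ (λ i → count-≡-∑ (R? i)))

∣∣-≡-∑ : (S : Subset n) → + ∣ S ∣ ≡ ∑[ i < n ] ⟦ i ∈? S ⟧
∣∣-≡-∑ [] = refl
∣∣-≡-∑ (true ∷ S) = trans (ℤP.pos-+ 1 ∣ S ∣) (cong (λ t → 1ℤ + t) (∣∣-≡-∑ S))
∣∣-≡-∑ (false ∷ S) = trans (∣∣-≡-∑ S) (sym (ℤP.+-identityˡ _))

infix 7 _·_
_·_ : Vector ℤ n → Vector ℤ n → ℤ
_·_ {n} u w = ∑[ i < n ] (u i * w i)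

lagrange-identity : (u w : Vector ℤ n) →
  ∑[ i < n ] ∑[ j < n ] ((u i * w j - u j * w i) * (u i * w j - u j * w i))
    ≡ + 2 * ((u · u) * (w · w) - (u · w) * (u · w))
lagrange-identity {n} u w = begin
  ∑[ i < n ] ∑[ j < n ] ((u i * w j - u j * w i) * (u i * w j - u j * w i))
    ≡⟨ sum-cong-≗ (λ i → sum-cong-≗ (λ j → expand (u i) (w i) (u j) (w j))) ⟩
  ∑[ i < n ] ∑[ j < n ] (uu i * ww j + ww i * uu j + (-[1+ 1 ] * uw i) * uw j)
    ≡⟨ ∑∑-distrib-+ (λ i j → uu i * ww j + ww i * uu j) (λ i j → (-[1+ 1 ] * uw i) * uw j) ⟩
  ∑[ i < n ] ∑[ j < n ] (uu i * ww j + ww i * uu j) + ∑[ i < n ] ∑[ j < n ] ((-[1+ 1 ] * uw i) * uw j)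
    ≡⟨ cong₂ _+_ (∑∑-distrib-+ (λ i j → uu i * ww j) (λ i j → ww i * uu j))
                 (∑∑-* (λ i → -[1+ 1 ] * uw i) uw) ⟩
  ∑[ i < n ] ∑[ j < n ] (uu i * ww j) + ∑[ i < n ] ∑[ j < n ] (ww i * uu j) + (∑[ i < n ] (-[1+ 1 ] * uw i)) * (u · w)
    ≡⟨ cong₂ (λ s t → s + t + (∑[ i < n ] (-[1+ 1 ] * uw i)) * (u · w)) (∑∑-* uu ww) (∑∑-* ww uu) ⟩
  (u · u) * (w · w) + (w · w) * (u · u) + (∑[ i < n ] (-[1+ 1 ] * uw i)) * (u · w)
    ≡⟨ cong (λ t → (u · u) * (w · w) + (w · w) * (u · u) + t * (u · w)) (sym (*-distribˡ-sum -[1+ 1 ] uw)) ⟩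
  (u · u) * (w · w) + (w · w) * (u · u) + (-[1+ 1 ] * (u · w)) * (u · w)
    ≡⟨ collect (u · u) (w · w) (u · w) ⟩
  + 2 * ((u · u) * (w · w) - (u · w) * (u · w)) ∎
  where
  open ≡-Reasoning
  uu ww uw : Vector ℤ n
  uu i = u i * u i
  ww i = w i * w i
  uw i = u i * w i
  expand : ∀ a b c d → (a * d - c * b) * (a * d - c * b) ≡ a * a * (d * d) + b * b * (c * c) + -[1+ 1 ] * (a * b) * (c * d)
  expand = solve-∀
  collect : ∀ α γ β → α * γ + γ * α + -[1+ 1 ] * β * β ≡ + 2 * (α * γ - β * β)
  collect = solve-∀

cauchy-schwarz : (u w : Vector ℤ n) → (u · w) * (u · w) ≤ (u · u) * (w · w)
cauchy-schwarz {n} u w = ℤP.0≤i-j⇒j≤i (ℤP.*-cancelˡ-≤-pos 0ℤ _ (+ 2) twice-gap≥0)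
  where
  twice-gap≥0 : + 2 * 0ℤ ≤ + 2 * ((u · u) * (w · w) - (u · w) * (u · w))
  twice-gap≥0 = subst (+ 2 * 0ℤ ≤_) (lagrange-identity u w)
    (∑-nonneg _ (λ i → ∑-nonneg _ (λ j → sq-nonneg (u i * w j - u j * w i))))

∑-affine : ∀ (c d : ℤ) (f : Vector ℤ n) → ∑[ i < n ] (c * f i + d) ≡ c * sum f + + n * d
∑-affine {n} c d f = begin
  ∑[ i < n ] (c * f i + d)
    ≡⟨ sum-cong-≗ (λ i → cong (λ t → c * f i + t) (sym (ℤP.*-identityˡ d))) ⟩
  ∑[ i < n ] (c * f i + 1ℤ * d)
    ≡⟨ ∑-distrib-+ (λ i → c * f i) (λ _ → 1ℤ * d) ⟩
  ∑[ i < n ] (c * f i) + ∑[ i < n ] (1ℤ * d)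
    ≡⟨ cong₂ _+_ (sym (*-distribˡ-sum c f)) (trans (∑-const n (1ℤ * d)) (cong (+ n *_) (ℤP.*-identityˡ d))) ⟩
  c * sum f + + n * d
    ∎
  where open ≡-Reasoning

·-affineʳ : ∀ (c d : ℤ) (u f : Vector ℤ n) → u · (λ i → c * f i + d) ≡ c * (u · f) + d * sum u
·-affineʳ {n} c d u f = begin
  ∑[ i < n ] (u i * (c * f i + d))      ≡⟨ sum-cong-≗ (λ i → distrib (u i) (f i) c d) ⟩
  ∑[ i < n ] (c * (u i * f i) + d * u i) ≡⟨ ∑-linear c d (λ i → u i * f i) u ⟩
  c * (u · f) + d * sum u                ∎
  where
  open ≡-Reasoning
  distrib : ∀ x y c d → x * (c * y + d) ≡ c * (x * y) + d * x
  distrib = solve-∀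

·-affineˡ : ∀ (c d : ℤ) (f w : Vector ℤ n) → (λ i → c * f i + d) · w ≡ c * (f · w) + d * sum w
·-affineˡ {n} c d f w = begin
  ∑[ i < n ] ((c * f i + d) * w i)      ≡⟨ sum-cong-≗ (λ i → distrib (f i) (w i) c d) ⟩
  ∑[ i < n ] (c * (f i * w i) + d * w i) ≡⟨ ∑-linear c d (λ i → f i * w i) w ⟩
  c * (f · w) + d * sum w                ∎
  where
  open ≡-Reasoning
  distrib : ∀ x y c d → (c * x + d) * y ≡ c * (x * y) + d * y
  distrib = solve-∀

Matrix : ℕ → Set
Matrix n = Fin n → Fin n → ℤ

infixr 8 _*ᵥ_
_*ᵥ_ : Matrix n → Vector ℤ n → Vector ℤ n
(A *ᵥ u) x = A x · u

module Gram≡J+qI {n : ℕ} (A : Matrix n) (q : ℤ)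
  (gram : ∀ y z → ∑[ x < n ] (A x y * A x z) ≡ 1ℤ + q * ⟦ y ≟ z ⟧) where

  ∣A*ᵥu∣² : (u : Vector ℤ n) → (A *ᵥ u) · (A *ᵥ u) ≡ sum u * sum u + q * (u · u)
  ∣A*ᵥu∣² u = begin
    ∑[ x < n ] ((A *ᵥ u) x * (A *ᵥ u) x)
      ≡⟨ sum-cong-≗ (λ x → sym (∑∑-* (λ y → A x y * u y) (λ z → A x z * u z))) ⟩
    ∑[ x < n ] ∑[ y < n ] ∑[ z < n ] (term x y z)
      ≡⟨ ∑-comm (λ x y → ∑[ z < n ] (term x y z)) ⟩
    ∑[ y < n ] ∑[ x < n ] ∑[ z < n ] (term x y z)
      ≡⟨ sum-cong-≗ (λ y → ∑-comm (λ x z → term x y z)) ⟩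
    ∑[ y < n ] ∑[ z < n ] ∑[ x < n ] (term x y z)
      ≡⟨ sum-cong-≗ (λ y → sum-cong-≗ (λ z → gram-entry y z)) ⟩
    ∑[ y < n ] ∑[ z < n ] (u y * u z + q * u y * (u z * ⟦ y ≟ z ⟧))
      ≡⟨ ∑∑-distrib-+ (λ y z → u y * u z) (λ y z → q * u y * (u z * ⟦ y ≟ z ⟧)) ⟩
    ∑[ y < n ] ∑[ z < n ] (u y * u z) + ∑[ y < n ] ∑[ z < n ] (q * u y * (u z * ⟦ y ≟ z ⟧))
      ≡⟨ cong₂ _+_ (∑∑-* u u) (sum-cong-≗ diagonal) ⟩
    sum u * sum u + ∑[ y < n ] (q * (u y * u y))
      ≡⟨ cong (λ t → sum u * sum u + t) (sym (*-distribˡ-sum q (λ y → u y * u y))) ⟩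
    sum u * sum u + q * (u · u) ∎
    where
    open ≡-Reasoning
    term : Fin n → Fin n → Fin n → ℤ
    term x y z = (A x y * u y) * (A x z * u z)
    gram-entry : ∀ y z → ∑[ x < n ] (term x y z) ≡ u y * u z + q * u y * (u z * ⟦ y ≟ z ⟧)
    gram-entry y z = begin
      ∑[ x < n ] (term x y z)                   ≡⟨ sum-cong-≗ (λ x → regroup (A x y) (u y) (A x z) (u z)) ⟩
      ∑[ x < n ] (u y * u z * (A x y * A x z))  ≡⟨ sym (*-distribˡ-sum (u y * u z) (λ x → A x y * A x z)) ⟩
      u y * u z * ∑[ x < n ] (A x y * A x z)    ≡⟨ cong (u y * u z *_) (gram y z) ⟩
      u y * u z * (1ℤ + q * ⟦ y ≟ z ⟧)      ≡⟨ distrib (u y) (u z) q ⟦ y ≟ z ⟧ ⟩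
      u y * u z + q * u y * (u z * ⟦ y ≟ z ⟧) ∎
      where
      regroup : ∀ a b c d → (a * b) * (c * d) ≡ b * d * (a * c)
      regroup = solve-∀
      distrib : ∀ a b q δ → a * b * (1ℤ + q * δ) ≡ a * b + q * a * (b * δ)
      distrib = solve-∀
    diagonal : ∀ y → ∑[ z < n ] (q * u y * (u z * ⟦ y ≟ z ⟧)) ≡ q * (u y * u y)
    diagonal y = begin
      ∑[ z < n ] (q * u y * (u z * ⟦ y ≟ z ⟧)) ≡⟨ sym (*-distribˡ-sum (q * u y) (λ z → u z * ⟦ y ≟ z ⟧)) ⟩
      q * u y * ∑[ z < n ] (u z * ⟦ y ≟ z ⟧)   ≡⟨ cong (q * u y *_) (∑-δ y u) ⟩
      q * u y * u y                                ≡⟨ ℤP.*-assoc q (u y) (u y) ⟩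
      q * (u y * u y)                              ∎

  quadratic-form-bound : (u : Vector ℤ n) → sum u ≡ 0ℤ →
                         (u · (A *ᵥ u)) * (u · (A *ᵥ u)) ≤ q * ((u · u) * (u · u))
  quadratic-form-bound u ∑u≡0 = subst (_ ≤_) ∣u∣²∣Au∣²≡ (cauchy-schwarz u (A *ᵥ u))
    where
    ∣u∣²∣Au∣²≡ : (u · u) * ((A *ᵥ u) · (A *ᵥ u)) ≡ q * ((u · u) * (u · u))
    ∣u∣²∣Au∣²≡ = begin
      (u · u) * ((A *ᵥ u) · (A *ᵥ u))       ≡⟨ cong ((u · u) *_) (∣A*ᵥu∣² u) ⟩
      (u · u) * (sum u * sum u + q * (u · u)) ≡⟨ cong (λ s → (u · u) * (s * s + q * (u · u))) ∑u≡0 ⟩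
      (u · u) * (0ℤ * 0ℤ + q * (u · u))       ≡⟨ simplify (u · u) q ⟩
      q * ((u · u) * (u · u))                 ∎
      where
      open ≡-Reasoning
      simplify : ∀ x q → x * (0ℤ * 0ℤ + q * x) ≡ q * (x * x)
      simplify = solve-∀

module RegularGram≡J+qI {n : ℕ} (A : Matrix n) (k q : ℤ)
  (rowsum : ∀ x → sum (A x) ≡ k)
  (colsum : ∀ y → ∑[ x < n ] A x y ≡ k)
  (gram : ∀ y z → ∑[ x < n ] (A x y * A x z) ≡ 1ℤ + q * ⟦ y ≟ z ⟧) where

  open Gram≡J+qI A q gram

  ∑-ones : ∑[ i < n ] 1ℤ ≡ + n
  ∑-ones = trans (∑-const n 1ℤ) (ℤP.*-identityʳ (+ n))

  ∑-*ᵥ : (v : Vector ℤ n) → sum (A *ᵥ v) ≡ k * sum v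
  ∑-*ᵥ v = begin
    ∑[ x < n ] ∑[ y < n ] (A x y * v y)   ≡⟨ ∑-comm (λ x y → A x y * v y) ⟩
    ∑[ y < n ] ∑[ x < n ] (A x y * v y)   ≡⟨ sum-cong-≗ (λ y → sym (*-distribʳ-sum (v y) (λ x → A x y))) ⟩
    ∑[ y < n ] (∑[ x < n ] A x y * v y)   ≡⟨ sum-cong-≗ (λ y → cong (_* v y) (colsum y)) ⟩
    ∑[ y < n ] (k * v y)                  ≡⟨ sym (*-distribˡ-sum k v) ⟩
    k * sum v                             ∎
    where open ≡-Reasoning

  k²≡n+q : .{{ℕ.NonZero n}} → k * k ≡ + n + q
  k²≡n+q = ℤP.*-cancelˡ-≡ (+ n) (k * k) (+ n + q) (begin
    + n * (k * k)                           ≡⟨ sym (∑-const n (k * k)) ⟩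
    ∑[ x < n ] (k * k)                      ≡⟨ sum-cong-≗ (λ x → sym (cong₂ _*_ (A*ᵥ1 x) (A*ᵥ1 x))) ⟩
    (A *ᵥ ones) · (A *ᵥ ones)               ≡⟨ ∣A*ᵥu∣² ones ⟩
    sum ones * sum ones + q * (ones · ones) ≡⟨ cong₂ (λ s t → s * s + q * t) ∑-ones ∑-ones ⟩
    + n * + n + q * + n                     ≡⟨ factor (+ n) q ⟩
    + n * (+ n + q)                         ∎)
    where
    open ≡-Reasoning
    ones : Vector ℤ n
    ones _ = 1ℤ
    A*ᵥ1 : ∀ x → (A *ᵥ ones) x ≡ k
    A*ᵥ1 x = trans (sum-cong-≗ (λ y → ℤP.*-identityʳ (A x y))) (rowsum x)
    factor : ∀ n q → n * n + q * n ≡ n * (n + q)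
    factor = solve-∀

  discrepancy-bound : .{{ℕ.NonZero n}} → (v : Vector ℤ n) → (∀ i → v i * v i ≡ v i) →
    (+ n * (v · (A *ᵥ v)) - k * sum v * sum v) * (+ n * (v · (A *ᵥ v)) - k * sum v * sum v)
      ≤ q * ((+ n * sum v - sum v * sum v) * (+ n * sum v - sum v * sum v))
  discrepancy-bound v v-idem = cancel-n² (begin
    + n * (+ n * (X * X))                          ≡⟨ scale² (+ n) X ⟩
    (+ n * X) * (+ n * X)                          ≡⟨ sym (cong₂ _*_ form form) ⟩
    (centred · (A *ᵥ centred)) * (centred · (A *ᵥ centred))
                                                   ≤⟨ quadratic-form-bound centred ∑centred≡0 ⟩
    q * ((centred · centred) * (centred · centred)) ≡⟨ cong (λ t → q * (t * t)) norm ⟩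
    q * ((+ n * Y) * (+ n * Y))                    ≡⟨ scale²-q q (+ n) Y ⟩
    + n * (+ n * (q * (Y * Y)))                    ∎)
    where
    open ℤP.≤-Reasoning
    s a X Y : ℤ
    s = sum v
    a = v · (A *ᵥ v)
    X = + n * a - k * s * s
    Y = + n * s - s * s
    cancel-n² : ∀ {x y} → + n * (+ n * x) ≤ + n * (+ n * y) → x ≤ y
    cancel-n² = ℤP.*-cancelˡ-≤-pos _ _ (+ n) {{n-positive}} ∘ ℤP.*-cancelˡ-≤-pos _ _ (+ n) {{n-positive}}
      where
      n-positive : ℤ.Positive (+ n)
      n-positive = ℤ.positive (ℤ.+<+ (ℕ.>-nonZero⁻¹ n))
    centred : Vector ℤ n
    centred i = + n * v i + - s
    ∑centred≡0 : sum centred ≡ 0ℤ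
    ∑centred≡0 = trans (∑-affine (+ n) (- s) v) (cancel (+ n) s)
      where
      cancel : ∀ m s → m * s + m * - s ≡ 0ℤ
      cancel = solve-∀
    form : centred · (A *ᵥ centred) ≡ + n * X
    form = begin-equality
      centred · (A *ᵥ centred)
        ≡⟨ sum-cong-≗ (λ x → cong (centred x *_) (A*ᵥcentred x)) ⟩
      centred · (λ x → + n * (A *ᵥ v) x + - s * k)
        ≡⟨ ·-affineʳ (+ n) (- s * k) centred (A *ᵥ v) ⟩
      + n * (centred · (A *ᵥ v)) + - s * k * sum centred
        ≡⟨ cong₂ (λ t u → + n * t + - s * k * u) (·-affineˡ (+ n) (- s) v (A *ᵥ v)) ∑centred≡0 ⟩
      + n * (+ n * a + - s * sum (A *ᵥ v)) + - s * k * 0ℤ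
        ≡⟨ cong (λ t → + n * (+ n * a + - s * t) + - s * k * 0ℤ) (∑-*ᵥ v) ⟩
      + n * (+ n * a + - s * (k * s)) + - s * k * 0ℤ
        ≡⟨ simplify (+ n) a s k ⟩
      + n * X ∎
      where
      simplify : ∀ m a s k → m * (m * a + - s * (k * s)) + - s * k * 0ℤ ≡ m * (m * a - k * s * s)
      simplify = solve-∀
      A*ᵥcentred : ∀ x → (A *ᵥ centred) x ≡ + n * (A *ᵥ v) x + - s * k
      A*ᵥcentred x = trans (·-affineʳ (+ n) (- s) (A x) v) (cong (λ t → + n * (A *ᵥ v) x + - s * t) (rowsum x))
    norm : centred · centred ≡ + n * Y
    norm = begin-equality
      centred · centred
        ≡⟨ ·-affineʳ (+ n) (- s) centred v ⟩
      + n * (centred · v) + - s * sum centred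
        ≡⟨ cong₂ (λ t u → + n * t + - s * u) (·-affineˡ (+ n) (- s) v v) ∑centred≡0 ⟩
      + n * (+ n * (v · v) + - s * s) + - s * 0ℤ
        ≡⟨ cong (λ t → + n * (+ n * t + - s * s) + - s * 0ℤ) (sum-cong-≗ v-idem) ⟩
      + n * (+ n * s + - s * s) + - s * 0ℤ
        ≡⟨ simplify (+ n) s ⟩
      + n * Y ∎
      where
      simplify : ∀ m s → m * (m * s + - s * s) + - s * 0ℤ ≡ m * (m * s - s * s)
      simplify = solve-∀
    scale² : ∀ m Z → m * (m * (Z * Z)) ≡ (m * Z) * (m * Z)
    scale² = solve-∀
    scale²-q : ∀ q m Z → q * ((m * Z) * (m * Z)) ≡ m * (m * (q * (Z * Z)))
    scale²-q = solve-∀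

module PolarityGraph {q : ℕ} (Π : ProjectivePlane q) (π : Polarity Π) where
  open ProjectivePlane Π
  open Polarity π

  adjacency : Matrix np
  adjacency x y = ⟦ I? x (πP y) ⟧

  adjacency-sym : ∀ x y → adjacency x y ≡ adjacency y x
  adjacency-sym x y = ⟦⟧-cong (I? x (πP y)) (I? y (πP x)) (flip-incidence x y) (flip-incidence y x)
    where
    flip-incidence : ∀ x y → I x (πP y) → I y (πP x)
    flip-incidence x y x∈y⊥ = subst (λ z → I z (πP x)) (invP y) (preserves x (πP y) x∈y⊥)

  πP-injective : ∀ {x y} → πP x ≡ πP y → x ≡ y
  πP-injective {x} {y} eq = trans (sym (invP x)) (trans (cong πL eq) (invP y))

  adjacency-colsum : ∀ y → ∑[ x < np ] adjacency x y ≡ + suc q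
  adjacency-colsum y = trans (sym (count-≡-∑ (λ x → I? x (πP y)))) (cong +_ (line-size (πP y)))

  adjacency-rowsum : ∀ x → sum (adjacency x) ≡ + suc q
  adjacency-rowsum x = trans (sum-cong-≗ (adjacency-sym x)) (adjacency-colsum x)

  adjacency-gram : ∀ y z → ∑[ x < np ] (adjacency x y * adjacency x z) ≡ 1ℤ + + q * ⟦ y ≟ z ⟧
  adjacency-gram y z with y ≟ z
  ... | yes refl = begin
    ∑[ x < np ] (adjacency x y * adjacency x y) ≡⟨ sum-cong-≗ (λ x → ⟦⟧-idem (I? x (πP y))) ⟩
    ∑[ x < np ] adjacency x y                   ≡⟨ adjacency-colsum y ⟩
    + suc q                                     ≡⟨ cong (λ t → 1ℤ + t) (sym (ℤP.*-identityʳ (+ q))) ⟩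
    1ℤ + + q * 1ℤ                               ∎
    where open ≡-Reasoning
  ... | no y≢z with two-lines (πP y) (πP z) (λ eq → y≢z (πP-injective eq))
  ...   | p , (p∈y⊥ , p∈z⊥) , unique = begin
    ∑[ x < np ] (adjacency x y * adjacency x z)
      ≡⟨ sum-cong-≗ (λ x → trans (sym (⟦⟧-× (I? x (πP y)) (I? x (πP z)))) (on-both x)) ⟩
    ∑[ x < np ] ⟦ p ≟ x ⟧
      ≡⟨ sym (sum-cong-≗ (λ x → ℤP.*-identityˡ ⟦ p ≟ x ⟧)) ⟩
    ∑[ x < np ] (1ℤ * ⟦ p ≟ x ⟧)
      ≡⟨ ∑-δ p (λ _ → 1ℤ) ⟩
    1ℤ
      ≡⟨ sym (cong (λ t → 1ℤ + t) (ℤP.*-zeroʳ (+ q))) ⟩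
    1ℤ + + q * 0ℤ ∎
    where
    open ≡-Reasoning
    on-both : ∀ x → ⟦ I? x (πP y) ×-dec I? x (πP z) ⟧ ≡ ⟦ p ≟ x ⟧
    on-both x = ⟦⟧-cong (I? x (πP y) ×-dec I? x (πP z)) (p ≟ x) unique λ { refl → p∈y⊥ , p∈z⊥ }

  open RegularGram≡J+qI adjacency (+ suc q) (+ q) adjacency-rowsum adjacency-colsum adjacency-gram
    using (k²≡n+q; discrepancy-bound)

  np≡q²+q+1 : .{{ℕ.NonZero np}} → np ≡ q ℕ.^ 2 ℕ.+ q ℕ.+ 1
  np≡q²+q+1 = ℕP.+-cancelʳ-≡ q np (q ℕ.^ 2 ℕ.+ q ℕ.+ 1) (ℤP.+-injective (begin
    + (np ℕ.+ q)                    ≡⟨ ℤP.pos-+ np q ⟩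
    + np + + q                      ≡⟨ sym k²≡n+q ⟩
    + suc q * + suc q               ≡⟨ sym (ℤP.pos-* (suc q) (suc q)) ⟩
    + (suc q ℕ.* suc q)             ≡⟨ cong +_ (square q) ⟩
    + (q ℕ.^ 2 ℕ.+ q ℕ.+ 1 ℕ.+ q)  ∎))
    where
    open ≡-Reasoning
    square : ∀ q → suc q ℕ.* suc q ≡ q ℕ.* (q ℕ.* 1) ℕ.+ q ℕ.+ 1 ℕ.+ q
    square = ℕ-solve-∀

  indicator : Subset np → Vector ℤ np
  indicator S i = ⟦ i ∈? S ⟧

  form≤2*edgesIn : (S : Subset np) → indicator S · (adjacency *ᵥ indicator S) ≤ + 2 * + edgesIn Π π S
  form≤2*edgesIn S = ℤP.0≤i-j⇒j≤i (subst (0ℤ ≤_) (sym gap≡loops) loops≥0)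
    where
    open ≡-Reasoning
    v : Vector ℤ np
    v = indicator S
    f : Fin np → Fin np → ℤ
    f p r = v p * (adjacency p r * v r)
    upper loops : ℤ
    upper = ∑[ p < np ] ∑[ r < np ] (⟦ toℕ p ℕ.<? toℕ r ⟧ * f p r)
    loops = ∑[ p < np ] f p p
    f-sym : ∀ p r → f p r ≡ f r p
    f-sym p r = trans (cong (λ t → v p * (t * v r)) (adjacency-sym p r)) (swap (v p) (adjacency r p) (v r))
      where
      swap : ∀ x a y → x * (a * y) ≡ y * (a * x)
      swap = solve-∀
    form≡ : v · (adjacency *ᵥ v) ≡ + 2 * upper + loops
    form≡ = trans (sum-cong-≗ (λ p → *-distribˡ-sum (v p) (λ r → adjacency p r * v r))) (∑∑-symmetric f f-sym)
    edge? : ∀ p r → Dec (p ∈ S × r ∈ S × toℕ p ℕ.< toℕ r × I p (πP r))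
    edge? p r = (p ∈? S) ×-dec ((r ∈? S) ×-dec ((toℕ p ℕ.<? toℕ r) ×-dec I? p (πP r)))
    loop? : ∀ p → Dec (p ∈ S × I p (πP p))
    loop? p = (p ∈? S) ×-dec I? p (πP p)
    edge-term : ∀ p r → ⟦ edge? p r ⟧ ≡ ⟦ toℕ p ℕ.<? toℕ r ⟧ * f p r
    edge-term p r = begin
      ⟦ edge? p r ⟧                                   ≡⟨ ⟦⟧-× (p ∈? S) ((r ∈? S) ×-dec (p<r ×-dec p∈r⊥)) ⟩
      v p * ⟦ (r ∈? S) ×-dec (p<r ×-dec p∈r⊥) ⟧       ≡⟨ cong (v p *_) (⟦⟧-× (r ∈? S) (p<r ×-dec p∈r⊥)) ⟩
      v p * (v r * ⟦ p<r ×-dec p∈r⊥ ⟧)               ≡⟨ cong (λ t → v p * (v r * t)) (⟦⟧-× p<r p∈r⊥) ⟩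
      v p * (v r * (⟦ p<r ⟧ * adjacency p r))         ≡⟨ regroup (v p) (v r) ⟦ p<r ⟧ (adjacency p r) ⟩
      ⟦ p<r ⟧ * f p r                                 ∎
      where
      p<r = toℕ p ℕ.<? toℕ r
      p∈r⊥ = I? p (πP r)
      regroup : ∀ x y l a → x * (y * (l * a)) ≡ l * (x * (a * y))
      regroup = solve-∀
    loop-term : ∀ p → ⟦ loop? p ⟧ ≡ f p p
    loop-term p = begin
      ⟦ loop? p ⟧                    ≡⟨ ⟦⟧-× (p ∈? S) (I? p (πP p)) ⟩
      v p * adjacency p p            ≡⟨ cong (_* adjacency p p) (sym (⟦⟧-idem (p ∈? S))) ⟩
      v p * v p * adjacency p p      ≡⟨ regroup (v p) (adjacency p p) ⟩
      f p p                          ∎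
      where
      regroup : ∀ x a → x * x * a ≡ x * (a * x)
      regroup = solve-∀
    edges≡ : + edgesIn Π π S ≡ upper + loops
    edges≡ = trans (ℤP.pos-+ (countPairs edge?) (count loop?)) (cong₂ _+_
      (trans (countPairs-≡-∑∑ edge?) (sum-cong-≗ (λ p → sum-cong-≗ (edge-term p))))
      (trans (count-≡-∑ loop?) (sum-cong-≗ loop-term)))
    gap≡loops : + 2 * + edgesIn Π π S - v · (adjacency *ᵥ v) ≡ loops
    gap≡loops = trans (cong₂ (λ e w → + 2 * e - w) edges≡ form≡) (cancel upper loops)
      where
      cancel : ∀ u l → + 2 * (u + l) - (+ 2 * u + l) ≡ l
      cancel = solve-∀
    loops≥0 : 0ℤ ≤ loops
    loops≥0 = ∑-nonneg (λ p → f p p) (λ p → subst (0ℤ ≤_) (loop-term p) (⟦⟧-nonneg (loop? p)))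

  edgesIn-discrepancy : (S : Subset np) → .{{ℕ.NonZero np}} →
    let X = suc q ℕ.* ∣ S ∣ ℕ.^ 2 ℕ.∸ 2 ℕ.* np ℕ.* edgesIn Π π S in
    + X * + X ≤ + q * ((+ np * + ∣ S ∣) * (+ np * + ∣ S ∣))
  edgesIn-discrepancy S = begin
    + X * + X                                  ≤⟨ ∸-sq-≤ (suc q ℕ.* k ℕ.^ 2) (2 ℕ.* np ℕ.* e) lower ⟩
    (Q * s * s - N * a) * (Q * s * s - N * a)  ≡⟨ flip (Q * s * s) (N * a) ⟩
    (N * a - Q * s * s) * (N * a - Q * s * s)  ≤⟨ discrepancy-bound v (λ i → ⟦⟧-idem (i ∈? S)) ⟩
    + q * ((N * s - s * s) * (N * s - s * s))  ≤⟨ ℤP.*-monoˡ-≤-nonNeg (+ q) (sq-[yx-x²]≤sq-yx s≥0 s≤N) ⟩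
    + q * ((N * s) * (N * s))                  ≡⟨ cong (λ t → + q * ((N * t) * (N * t))) s≡k ⟩
    + q * ((N * + k) * (N * + k))              ∎
    where
    open ℤP.≤-Reasoning
    k e X : ℕ
    k = ∣ S ∣
    e = edgesIn Π π S
    X = suc q ℕ.* k ℕ.^ 2 ℕ.∸ 2 ℕ.* np ℕ.* e
    v : Vector ℤ np
    v = indicator S
    N Q s a : ℤ
    N = + np
    Q = + suc q
    s = sum v
    a = v · (adjacency *ᵥ v)
    s≡k : s ≡ + k
    s≡k = sym (∣∣-≡-∑ S)
    s≥0 : 0ℤ ≤ s
    s≥0 = subst (0ℤ ≤_) (sym s≡k) (+≤+ z≤n)
    s≤N : s ≤ N
    s≤N = subst (_≤ N) (sym s≡k) (+≤+ (∣p∣≤n S))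
    flip : ∀ x y → (x - y) * (x - y) ≡ (y - x) * (y - x)
    flip = solve-∀
    regroup : ∀ N e → + 2 * N * e ≡ N * (+ 2 * e)
    regroup = solve-∀
    Qss≡ : + (suc q ℕ.* k ℕ.^ 2) ≡ Q * s * s
    Qss≡ = trans (ℤP.pos-* (suc q) (k ℕ.^ 2)) (trans (cong (Q *_) (pos-^2 k))
             (trans (sym (ℤP.*-assoc Q (+ k) (+ k))) (cong (λ t → Q * t * t) (sym s≡k))))
    2Ne≡ : + (2 ℕ.* np ℕ.* e) ≡ N * (+ 2 * + e)
    2Ne≡ = trans (ℤP.pos-* (2 ℕ.* np) e) (trans (cong (_* + e) (ℤP.pos-* 2 np)) (regroup N (+ e)))
    lower : + (suc q ℕ.* k ℕ.^ 2) - + (2 ℕ.* np ℕ.* e) ≤ Q * s * s - N * a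
    lower = begin
      + (suc q ℕ.* k ℕ.^ 2) - + (2 ℕ.* np ℕ.* e) ≡⟨ cong₂ _-_ Qss≡ 2Ne≡ ⟩
      Q * s * s - N * (+ 2 * + e)                ≤⟨ ℤP.+-monoʳ-≤ (Q * s * s) (ℤP.neg-mono-≤ Na≤N2e) ⟩
      Q * s * s - N * a                          ∎
      where
      Na≤N2e : N * a ≤ N * (+ 2 * + e)
      Na≤N2e = ℤP.*-monoˡ-≤-nonNeg N (form≤2*edgesIn S)

  edgesIn-bound : (S : Subset np) → .{{ℕ.NonZero np}} →
    ((suc q ℕ.* ∣ S ∣ ℕ.^ 2) ℕ.∸ (2 ℕ.* (q ℕ.^ 2 ℕ.+ q ℕ.+ 1) ℕ.* edgesIn Π π S)) ℕ.^ 2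
      ℕ.≤ q ℕ.* (q ℕ.^ 2 ℕ.+ q ℕ.+ 1) ℕ.^ 2 ℕ.* ∣ S ∣ ℕ.^ 2
  edgesIn-bound S rewrite sym np≡q²+q+1 = ℤP.drop‿+≤+ (subst₂ _≤_
    (sym (pos-^2 (suc q ℕ.* ∣ S ∣ ℕ.^ 2 ℕ.∸ 2 ℕ.* np ℕ.* edgesIn Π π S)))
    (sym (pos-a*b²*c² q np ∣ S ∣))
    (edgesIn-discrepancy S))

-- The axioms of a projective plane hold vacuously when np = nl = 0, so np = q² + q + 1
-- is only available once S is nonempty.
lemma4 : (q : ℕ) (Π : ProjectivePlane q) (π : Polarity Π)
    (S : Subset (ProjectivePlane.np Π)) →
    ((suc q ℕ.* ∣ S ∣ ℕ.^ 2) ℕ.∸ (2 ℕ.* (q ℕ.^ 2 ℕ.+ q ℕ.+ 1) ℕ.* edgesIn Π π S)) ℕ.^ 2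
    ℕ.≤ q ℕ.* (q ℕ.^ 2 ℕ.+ q ℕ.+ 1) ℕ.^ 2 ℕ.* ∣ S ∣ ℕ.^ 2
lemma4 q Π π S with ∣ S ∣ ℕ.≟ 0
... | yes |S|≡0
  rewrite |S|≡0 | ℕP.*-zeroʳ q | ℕP.0∸n≡0 (2 ℕ.* (q ℕ.^ 2 ℕ.+ q ℕ.+ 1) ℕ.* edgesIn Π π S) = z≤n
... | no |S|≢0 = PolarityGraph.edgesIn-bound Π π S {{ℕ.≢-nonZero np≢0}}
  where
  np≢0 : ProjectivePlane.np Π ≢ 0
  np≢0 np≡0 = |S|≢0 (ℕP.n≤0⇒n≡0 (subst (∣ S ∣ ℕ.≤_) np≡0 (∣p∣≤n S)))
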